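{- Let $T[0..n)$ be a text and $P[0..m)$ a pattern, and let $\mathsf{eMS}$ be the extended matching statistics of $P$ with respect to $T$. For $i\in[0..m)$ let $w_i=P[i..i+\mathsf{eMS}[i].\mathsf{len})$, and let $\mathcal{L}\subseteq[0..m)$ be the set of positions $i$ such that $w_i$ is a maximal match and occurs exactly once in $T$. Then for every $i\in\mathcal{L}$: $w_i$ occurs only once in $P$ if and only if for all $i'\in\mathcal{L}\setminus\{i\}$, either $\mathsf{eMS}[i].\mathsf{pos}<\mathsf{eMS}[i'].\mathsf{pos}$ or $\mathsf{eMS}[i].\mathsf{len}+\mathsf{eMS}[i].\mathsf{pos} > \mathsf{eMS}[i'].\mathsf{len}+\mathsf{eMS}[i'].\mathsf{pos}$.
   Context: Strings are indexed from $0$; $S[i..j)=S[i]S[i+1]\cdots S[j-1]$ (empty if $i\ge j$). The text $T$ ends with a terminator $\$$ occurring nowhere else, lexicographically smallest. A match is a pair $(i,\ell)$ such that the factor $P[i..i+\ell)$ occurs in $T$; it is maximal if either $i=0$ or $P[i-1..i+\ell)$ does not occur in $T$, and either $i=m-\ell$ or $P[i..i+\ell+1)$ does not occur in $T$. The extended matching statistics $\mathsf{eMS}[0..m)$ is an array of triples $(\mathsf{pos},\mathsf{len},\mathsf{twice})$ such that for each $i$: $P[i..i+\mathsf{eMS}[i].\mathsf{len}) = T[\mathsf{eMS}[i].\mathsf{pos}..\mathsf{eMS}[i].\mathsf{pos}+\mathsf{eMS}[i].\mathsf{len})$; either $i=m-\mathsf{eMS}[i].\mathsf{len}$ or $P[i..i+\mathsf{eMS}[i].\mathsf{len}+1)$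 does not occur in $T$; and $\mathsf{eMS}[i].\mathsf{twice}$ is the largest $\ell$ for which there exists a position $p\neq \mathsf{eMS}[i].\mathsf{pos}$ with $P[i..i+\ell)=T[p..p+\ell)$. -}

module Defs where

open import Data.Nat using (ℕ; zero; suc; _+_; _∸_; _≤_; _<_)
open import Data.List using (List; take; drop; length; _++_; [_])
open import Data.List.Membership.Propositional using (_∈_)
open import Data.Product using (Σ; ∃; _×_; _,_)
open import Data.Sum using (_⊎_)
open import Relation.Binary.PropositionalEquality using (_≡_; _≢_)
open import Relation.Nullary using (¬_)

module _ {A : Set} where

  factor : List A → ℕ → ℕ → List A
  factor S i ℓ = take ℓ (drop i S)

  OccAt : List A → List A → ℕ → Set
  OccAt S w p = (p + length w ≤ length S) × (factor S p (length w) ≡ w)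

  Occurs : List A → List A → Set
  Occurs S w = ∃ λ p → OccAt S w p

  OccursOnce : List A → List A → Set
  OccursOnce S w = Occurs S w × (∀ p q → OccAt S w p → OccAt S w q → p ≡ q)

  EndsWithTerminator : List A → A → Set
  EndsWithTerminator T $ = Σ (List A) λ T' → (T ≡ T' ++ [ $ ]) × ¬ ($ ∈ T')

  Match : List A → List A → ℕ → ℕ → Set
  Match T P i ℓ = (i + ℓ ≤ length P) × Occurs T (factor P i ℓ)

  MaximalMatch : List A → List A → ℕ → ℕ → Set
  MaximalMatch T P i ℓ =
    Match T P i ℓ
    × (i ≡ 0 ⊎ ¬ Occurs T (factor P (i ∸ 1) (suc ℓ)))
    × (i ≡ length P ∸ ℓ ⊎ ¬ Occurs T (factor P i (suc ℓ)))

record Triple : Set where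
  constructor triple
  field
    pos   : ℕ
    len   : ℕ
    twice : ℕ
open Triple public

module _ {A : Set} where

  -- eMS : ℕ → Triple is the extended matching statistics of P w.r.t. T
  -- (only the entries i < |P| are constrained)
  IsEMS : List A → List A → (ℕ → Triple) → Set
  IsEMS T P eMS = ∀ i → i < length P →
      ((i + len (eMS i) ≤ length P)
       × OccAt T (factor P i (len (eMS i))) (pos (eMS i)))
    ×
      (i ≡ length P ∸ len (eMS i) ⊎ ¬ Occurs T (factor P i (suc (len (eMS i)))))
    ×
      ( ((i + twice (eMS i) ≤ length P)
         × ∃ λ p → p ≢ pos (eMS i) × OccAt T (factor P i (twice (eMS i))) p)
      × (∀ ℓ p → i + ℓ ≤ length P → p ≢ pos (eMS i)
           → OccAt T (factor P i ℓ) p → ℓ ≤ twice (eMS i)))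

  w : List A → (ℕ → Triple) → ℕ → List A
  w P eMS i = factor P i (len (eMS i))

  InL : List A → List A → (ℕ → Triple) → ℕ → Set
  InL T P eMS i = (i < length P)
    × MaximalMatch T P i (len (eMS i))
    × OccursOnce T (w P eMS i)

-- If the T-occurrence of w_i lies inside that of w_i', at offset k, then w_i also
-- occurs in P at i' + k. When w_i is unique in P this forces i' + k = i, so either
-- i' = i or w_i' extends w_i to the left in T, against the maximality of i.
-- Conversely, for an occurrence j of w_i in P take the leftmost s ≤ j with
-- s + |w_s| ≥ j + |w_i|. Then w_s contains w_i at offset k = j − s, so w_s is unique
-- in T because w_i is, and the T-occurrence of w_i sits at offset k inside that of
-- w_s; minimality of s makes s left-maximal, so s ∈ 𝓛. Separation now rules out
-- s ≠ i, and s = i gives k = 0, i.e. j = i.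
module Submission where

open import Defs
open import Data.Nat using (ℕ; zero; suc; _+_; _∸_; _⊓_; _≤_; _<_; _>_; z≤n; _≤?_; _<?_; _≟_)
open import Data.Nat.Properties
open import Data.List using (List; []; take; drop; length)
open import Data.List.Properties using (length-take; length-drop; take-take; take-drop; drop-drop; length-++)
open import Data.Sum using (_⊎_; inj₁; inj₂)
open import Data.Product using (_×_; _,_; ∃; ∃₂; proj₁; proj₂)
open import Data.Empty using (⊥; ⊥-elim)
open import Relation.Nullary using (¬_; yes; no; contradiction)
open import Relation.Nullary.Decidable using (_⊎-dec_)
open import Relation.Binary using (IsStrictTotalOrder)
open import Relation.Binary.PropositionalEquality
open import Function using (_∘_)

subinterval-fits : ∀ x {ℓ k l m} → x + ℓ ≤ m → k + l ≤ ℓ → x + k + l ≤ m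
subinterval-fits x {k = k} {l} x+ℓ≤m k+l≤ℓ =
  ≤-trans (≤-reflexive (+-assoc x k l)) (≤-trans (+-monoʳ-≤ x k+l≤ℓ) x+ℓ≤m)

-- ¬ (p < p' ⊎ l + p > l' + p') says that [p, p + l) lies inside [p', p' + l').
module _ {p l p' l' : ℕ} where

  private
    shift : ∀ k → k + l + p' ≡ l + (p' + k)
    shift k = trans (cong (_+ p') (+-comm k l)) (trans (+-assoc l k p') (cong (l +_) (+-comm k p')))

  ¬separated⇒offset : ¬ (p < p' ⊎ l + p > l' + p') → ∃ λ k → p' + k ≡ p × k + l ≤ l'
  ¬separated⇒offset ¬separated = p ∸ p' , p'+k≡p , +-cancelʳ-≤ p' _ _ (begin
      p ∸ p' + l + p'     ≡⟨ shift (p ∸ p') ⟩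
      l + (p' + (p ∸ p')) ≡⟨ cong (l +_) p'+k≡p ⟩
      l + p               ≤⟨ ≮⇒≥ (¬separated ∘ inj₂) ⟩
      l' + p'             ∎)
    where
      open ≤-Reasoning
      p'+k≡p : p' + (p ∸ p') ≡ p
      p'+k≡p = m+[n∸m]≡n (≮⇒≥ (¬separated ∘ inj₁))

  offset⇒¬separated : ∀ {k} → p' + k ≡ p → k + l ≤ l' → ¬ (p < p' ⊎ l + p > l' + p')
  offset⇒¬separated {k} p'+k≡p _ (inj₁ p<p') =
    <⇒≱ p<p' (subst (p' ≤_) p'+k≡p (m≤m+n p' k))
  offset⇒¬separated {k} p'+k≡p k+l≤l' (inj₂ end<) = <⇒≱ end< (begin
    l + p         ≡⟨ cong (l +_) p'+k≡p ⟨
    l + (p' + k)  ≡⟨ shift k ⟨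
    k + l + p'    ≤⟨ +-monoˡ-≤ p' k+l≤l' ⟩
    l' + p'       ∎)
    where open ≤-Reasoning

leftmost-reaching : (f : ℕ → ℕ) (t j : ℕ) → t ≤ f j →
  ∃ λ s → s ≤ j × t ≤ f s × (∀ s' → s ≡ suc s' → f s' < t)
leftmost-reaching f t zero t≤fj = zero , z≤n , t≤fj , λ _ ()
leftmost-reaching f t (suc j) t≤fj with t ≤? f j
... | no t≰fj = suc j , ≤-refl , t≤fj , λ { _ refl → ≰⇒> t≰fj }
... | yes t≤fj′ with leftmost-reaching f t j t≤fj′
...   | s , s≤j , t≤fs , below = s , m≤n⇒m≤1+n s≤j , t≤fs , below

module _ {A : Set} where

  length-factor : ∀ (S : List A) p l → p + l ≤ length S → length (factor S p l) ≡ l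
  length-factor S p l p+l≤ = begin
    length (take l (drop p S)) ≡⟨ length-take l (drop p S) ⟩
    l ⊓ length (drop p S)      ≡⟨ cong (l ⊓_) (length-drop p S) ⟩
    l ⊓ (length S ∸ p)         ≡⟨ m≤n⇒m⊓n≡m (m+n≤o⇒m≤o∸n l (subst (_≤ length S) (+-comm p l) p+l≤)) ⟩
    l                          ∎
    where open ≡-Reasoning

  factor-factor : ∀ (S : List A) p ℓ k l → k + l ≤ ℓ → factor (factor S p ℓ) k l ≡ factor S (p + k) l
  factor-factor S p ℓ k l k+l≤ℓ = begin
    take l (drop k (take ℓ (drop p S)))        ≡⟨ take-drop l k _ ⟩
    drop k (take (k + l) (take ℓ (drop p S)))  ≡⟨ cong (drop k) (take-take (k + l) ℓ _) ⟩
    drop k (take ((k + l) ⊓ ℓ) (drop p S))     ≡⟨ cong (λ n → drop k (take n (drop p S))) (m≤n⇒m⊓n≡m k+l≤ℓ) ⟩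
    drop k (take (k + l) (drop p S))           ≡⟨ take-drop l k (drop p S) ⟨
    take l (drop k (drop p S))                 ≡⟨ cong (take l) (drop-drop p k S) ⟩
    take l (drop (p + k) S)                    ∎
    where open ≡-Reasoning

  occAt-self : ∀ (S : List A) x l → x + l ≤ length S → OccAt S (factor S x l) x
  occAt-self S x l x+l≤ rewrite length-factor S x l x+l≤ = x+l≤ , refl

  occAt-unique-word : ∀ {S u v : List A} {q} → length u ≡ length v → OccAt S u q → OccAt S v q → u ≡ v
  occAt-unique-word {S} {q = q} |u|≡|v| (_ , u-at-q) (_ , v-at-q) =
    trans (sym u-at-q) (trans (cong (factor S q) |u|≡|v|) v-at-q)

  occAt-subfactor : ∀ (S P : List A) x ℓ {q} k l → x + ℓ ≤ length P → k + l ≤ ℓ →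
    OccAt S (factor P x ℓ) q → OccAt S (factor P (x + k) l) (q + k)
  occAt-subfactor S P x ℓ {q} k l x+ℓ≤ k+l≤ℓ (fits , matches) = fits′ , matches′
    where
      |u| : length (factor P x ℓ) ≡ ℓ
      |u| = length-factor P x ℓ x+ℓ≤
      |v| : length (factor P (x + k) l) ≡ l
      |v| = length-factor P (x + k) l (subinterval-fits x x+ℓ≤ k+l≤ℓ)
      fits′ : q + k + length (factor P (x + k) l) ≤ length S
      fits′ = begin
        q + k + length (factor P (x + k) l) ≡⟨ cong (q + k +_) |v| ⟩
        q + k + l                           ≡⟨ +-assoc q k l ⟩
        q + (k + l)                         ≤⟨ +-monoʳ-≤ q k+l≤ℓ ⟩
        q + ℓ                               ≡⟨ cong (q +_) |u| ⟨
        q + length (factor P x ℓ)           ≤⟨ fits ⟩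
        length S                            ∎
        where open ≤-Reasoning
      matches′ : factor S (q + k) (length (factor P (x + k) l)) ≡ factor P (x + k) l
      matches′ = begin
        factor S (q + k) (length (factor P (x + k) l))   ≡⟨ cong (factor S (q + k)) |v| ⟩
        factor S (q + k) l                               ≡⟨ factor-factor S q ℓ k l k+l≤ℓ ⟨
        factor (factor S q ℓ) k l                        ≡⟨ cong (λ n → factor (factor S q n) k l) |u| ⟨
        factor (factor S q (length (factor P x ℓ))) k l  ≡⟨ cong (λ u → factor u k l) matches ⟩
        factor (factor P x ℓ) k l                        ≡⟨ factor-factor P x ℓ k l k+l≤ℓ ⟩
        factor P (x + k) l                               ∎
        where open ≡-Reasoning

  occurs-subfactor : ∀ (S P : List A) x ℓ k l → x + ℓ ≤ length P → k + l ≤ ℓ →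
    Occurs S (factor P x ℓ) → Occurs S (factor P (x + k) l)
  occurs-subfactor S P x ℓ k l x+ℓ≤ k+l≤ℓ (q , occ) = q + k , occAt-subfactor S P x ℓ k l x+ℓ≤ k+l≤ℓ occ

  occurs-prefix : ∀ (S P : List A) x {ℓ l} → x + ℓ ≤ length P → l ≤ ℓ →
    Occurs S (factor P x ℓ) → Occurs S (factor P x l)
  occurs-prefix S P x {ℓ} {l} x+ℓ≤ l≤ℓ occ =
    subst (λ y → Occurs S (factor P y l)) (+-identityʳ x) (occurs-subfactor S P x ℓ 0 l x+ℓ≤ l≤ℓ occ)

  occursOnce-superword : ∀ {S u v : List A} k → OccursOnce S u →
    (∀ {a} → OccAt S v a → OccAt S u (a + k)) → Occurs S v → OccursOnce S v
  occursOnce-superword k (_ , u-unique) v⇒u v-occ =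
    v-occ , λ a b a-occ b-occ → +-cancelʳ-≡ k a b (u-unique _ _ (v⇒u a-occ) (v⇒u b-occ))

  ¬occursOnce-[] : ∀ (S : List A) → 0 < length S → ¬ OccursOnce S []
  ¬occursOnce-[] S 0<|S| (_ , unique) with unique 0 1 (z≤n , refl) (0<|S| , refl)
  ... | ()

  terminated-nonempty : ∀ {T : List A} {$} → EndsWithTerminator T $ → 0 < length T
  terminated-nonempty (T′ , refl , _) = subst (0 <_) (sym (length-++ T′)) (m≤n+m 1 (length T′))

module MatchingStatistics {A : Set} (T P : List A) (eMS : ℕ → Triple) (isEMS : IsEMS T P eMS) where

  L ps : ℕ → ℕ
  L x = len (eMS x)
  ps x = pos (eMS x)

  Separated : ℕ → ℕ → Set
  Separated i i' = ps i < ps i' ⊎ L i + ps i > L i' + ps i'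

  w-fits : ∀ {x} → x < length P → x + L x ≤ length P
  w-fits x<m = proj₁ (proj₁ (isEMS _ x<m))

  w-occurs : ∀ {x} → x < length P → OccAt T (w P eMS x) (ps x)
  w-occurs x<m = proj₂ (proj₁ (isEMS _ x<m))

  length-w : ∀ {x} → x < length P → length (w P eMS x) ≡ L x
  length-w {x} x<m = length-factor P x (L x) (w-fits x<m)

  right-maximal : ∀ {x} → x < length P → x ≡ length P ∸ L x ⊎ ¬ Occurs T (factor P x (suc (L x)))
  right-maximal x<m = proj₁ (proj₂ (isEMS _ x<m))

  len-maximal : ∀ {x ℓ} → x < length P → x + ℓ ≤ length P → Occurs T (factor P x ℓ) → ℓ ≤ L x
  len-maximal {x} {ℓ} x<m x+ℓ≤m occ with ℓ ≤? L x
  ... | yes ℓ≤L = ℓ≤L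
  ... | no ℓ≰L with right-maximal x<m
  ...   | inj₂ ¬longer = contradiction (occurs-prefix T P x x+ℓ≤m (≰⇒> ℓ≰L) occ) ¬longer
  ...   | inj₁ x≡m∸L = contradiction
          (+-cancelˡ-≤ x _ _ (≤-trans (+-monoʳ-≤ x (≰⇒> ℓ≰L)) (subst (x + ℓ ≤_) (sym x+L≡m) x+ℓ≤m)))
          (<-irrefl refl)
    where
      x+L≡m : x + L x ≡ length P
      x+L≡m = trans (cong (_+ L x) x≡m∸L) (m∸n+n≡m (m+n≤o⇒n≤o x (w-fits x<m)))

  w-nonempty : 0 < length T → ∀ {x} → InL T P eMS x → 0 < L x
  w-nonempty 0<|T| {x} (_ , _ , once) =
    n≢0⇒n>0 λ L≡0 → ¬occursOnce-[] T 0<|T| (subst (λ n → OccursOnce T (factor P x n)) L≡0 once)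

  left-maximal : ∀ {x y} → InL T P eMS y → suc x ≡ y → ¬ Occurs T (factor P x (suc (L y)))
  left-maximal (_ , (_ , inj₁ () , _) , _) refl
  left-maximal (_ , (_ , inj₂ ¬occ , _) , _) refl = ¬occ

  -- Extending w_{x+1} one letter to the left would make w_x reach beyond it.
  reach-increase⇒left-maximal : ∀ {x} → suc x < length P → x + L x < suc x + L (suc x) →
    ¬ Occurs T (factor P x (suc (L (suc x))))
  reach-increase⇒left-maximal {x} sx<m reach< occ = <⇒≱ reach< (begin
    suc x + L (suc x)   ≡⟨ +-suc x (L (suc x)) ⟨
    x + suc (L (suc x)) ≤⟨ +-monoʳ-≤ x (len-maximal (<⇒≤ sx<m) fits occ) ⟩
    x + L x             ∎)
    where
      open ≤-Reasoning
      fits : x + suc (L (suc x)) ≤ length P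
      fits = subst (_≤ length P) (sym (+-suc x (L (suc x)))) (w-fits sx<m)

  InL-intro : ∀ {x} → x < length P → (x ≡ 0 ⊎ ¬ Occurs T (factor P (x ∸ 1) (suc (L x)))) →
    OccursOnce T (w P eMS x) → InL T P eMS x
  InL-intro x<m left once = x<m , ((w-fits x<m , _ , w-occurs x<m) , left , right-maximal x<m) , once

  once-in-P⇒separated : ∀ {i} → InL T P eMS i → OccursOnce P (w P eMS i) →
    ∀ i' → i' < length P → i' ≢ i → Separated i i'
  once-in-P⇒separated {i} i∈L@(i<m , _) (_ , P-unique) i' i'<m i'≢i
    with (ps i <? ps i') ⊎-dec (L i' + ps i' <? L i + ps i)
  ... | yes separated = separated
  ... | no ¬separated with ¬separated⇒offset ¬separated
  ...   | k , offset , k+Li≤ = ⊥-elim (shifted-left k at-i k+Li≤)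
    where
      fits : i' + k + L i ≤ length P
      fits = subinterval-fits i' (w-fits i'<m) k+Li≤
      in-T : OccAt T (factor P (i' + k) (L i)) (ps i)
      in-T = subst (OccAt T _) offset
        (occAt-subfactor T P i' (L i') k (L i) (w-fits i'<m) k+Li≤ (w-occurs i'<m))
      same : factor P (i' + k) (L i) ≡ w P eMS i
      same = occAt-unique-word (trans (length-factor P (i' + k) (L i) fits) (sym (length-w i<m)))
        in-T (w-occurs i<m)
      at-i : i' + k ≡ i
      at-i = P-unique _ _ (subst (λ u → OccAt P u (i' + k)) same (occAt-self P (i' + k) (L i) fits))
                          (occAt-self P i (L i) (w-fits i<m))
      shifted-left : ∀ k → i' + k ≡ i → k + L i ≤ L i' → ⊥
      shifted-left zero i'+0≡i _ = i'≢i (trans (sym (+-identityʳ i')) i'+0≡i)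
      shifted-left (suc k′) i'+k≡i k+Li≤′ = left-maximal i∈L (trans (sym (+-suc i' k′)) i'+k≡i)
        (occurs-subfactor T P i' (L i') k′ (suc (L i)) (w-fits i'<m)
          (subst (_≤ L i') (sym (+-suc k′ (L i))) k+Li≤′) (_ , w-occurs i'<m))

  leftmost⇒left-maximal : ∀ {s t} → s < length P → t ≤ s + L s → (∀ s' → s ≡ suc s' → s' + L s' < t) →
    s ≡ 0 ⊎ ¬ Occurs T (factor P (s ∸ 1) (suc (L s)))
  leftmost⇒left-maximal {zero} _ _ _ = inj₁ refl
  leftmost⇒left-maximal {suc s} s<m reaches below =
    inj₂ (reach-increase⇒left-maximal s<m (<-≤-trans (below s refl) reaches))

  -- w_s, with s ∈ 𝓛, contains the occurrence of w_i at j at offset k, both in P and in T.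
  Covers : ℕ → ℕ → ℕ → ℕ → Set
  Covers s k i j = InL T P eMS s × s + k ≡ j × ps s + k ≡ ps i × k + L i ≤ L s

  leftmost-cover : ∀ {i j s} → InL T P eMS i → factor P j (L i) ≡ w P eMS i → j < length P →
    s ≤ j → j + L i ≤ s + L s → (∀ s' → s ≡ suc s' → s' + L s' < j + L i) →
    ∃ λ k → Covers s k i j
  leftmost-cover {i} {j} {s} (i<m , _ , T-once@(_ , T-unique)) j-factor j<m s≤j reaches below =
    k , s∈L , s+k≡j , offset (w-occurs s<m) , k+Li≤Ls
    where
      s<m : s < length P
      s<m = ≤-<-trans s≤j j<m
      k = j ∸ s
      s+k≡j : s + k ≡ j
      s+k≡j = m+[n∸m]≡n s≤j
      k+Li≤Ls : k + L i ≤ L s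
      k+Li≤Ls = +-cancelˡ-≤ s _ _
        (subst (_≤ s + L s) (trans (cong (_+ L i) (sym s+k≡j)) (+-assoc s k (L i))) reaches)
      inside : ∀ {a} → OccAt T (w P eMS s) a → OccAt T (w P eMS i) (a + k)
      inside {a} occ = subst (λ u → OccAt T u (a + k))
        (trans (cong (λ y → factor P y (L i)) s+k≡j) j-factor) (occAt-subfactor T P s (L s) k (L i) (w-fits s<m) k+Li≤Ls occ)
      offset : ∀ {a} → OccAt T (w P eMS s) a → a + k ≡ ps i
      offset occ = T-unique _ _ (inside occ) (w-occurs i<m)
      s∈L : InL T P eMS s
      s∈L = InL-intro s<m (leftmost⇒left-maximal s<m reaches below)
        (occursOnce-superword k T-once inside (_ , w-occurs s<m))

  covering-match : 0 < length T → ∀ {i j} → InL T P eMS i → OccAt P (w P eMS i) j →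
    ∃₂ λ s k → Covers s k i j
  covering-match 0<|T| {i} {j} i∈L@(i<m , _) (fits , matches) =
    let s , s≤j , reaches , below = leftmost-reaching (λ x → x + L x) (j + L i) j j-reaches
    in s , leftmost-cover i∈L j-factor j<m s≤j reaches below
    where
      j+Li≤m : j + L i ≤ length P
      j+Li≤m = subst (λ n → j + n ≤ length P) (length-w i<m) fits
      j<m : j < length P
      j<m = <-≤-trans (m<m+n j (w-nonempty 0<|T| i∈L)) j+Li≤m
      j-factor : factor P j (L i) ≡ w P eMS i
      j-factor = trans (cong (factor P j) (sym (length-w i<m))) matches
      j-reaches : j + L i ≤ j + L j
      j-reaches = +-monoʳ-≤ j (len-maximal j<m j+Li≤m
        (_ , subst (λ u → OccAt T u (ps i)) (sym j-factor) (w-occurs i<m)))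

  separated⇒once-in-P : 0 < length T → ∀ {i} → InL T P eMS i →
    (∀ i' → InL T P eMS i' → i' ≢ i → Separated i i') → OccursOnce P (w P eMS i)
  separated⇒once-in-P 0<|T| {i} i∈L@(i<m , _) separated =
    (i , occAt-self P i (L i) (w-fits i<m)) , λ a b a-occ b-occ → trans (at-i a-occ) (sym (at-i b-occ))
    where
      covered-by-i : ∀ {j} → (∃₂ λ s k → Covers s k i j) → j ≡ i
      covered-by-i (s , k , s∈L , s+k≡j , offset , k+Li≤Ls) with s ≟ i
      ... | no s≢i = ⊥-elim (offset⇒¬separated offset k+Li≤Ls (separated s s∈L s≢i))
      ... | yes refl = trans (sym s+k≡j) (trans (cong (i +_) k≡0) (+-identityʳ i))
        where
          k≡0 : k ≡ 0
          k≡0 = +-cancelˡ-≡ (ps i) k 0 (trans offset (sym (+-identityʳ (ps i))))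
      at-i : ∀ {j} → OccAt P (w P eMS i) j → j ≡ i
      at-i j-occ = covered-by-i (covering-match 0<|T| i∈L j-occ)

lemma4 : {A : Set} (_≺_ : A → A → Set) → IsStrictTotalOrder _≡_ _≺_ →
    (T P : List A) ($ : A) →
    EndsWithTerminator T $ →
    (∀ c → c ≢ $ → $ ≺ c) →
    (eMS : ℕ → Triple) → IsEMS T P eMS →
    ∀ i → InL T P eMS i →
      (OccursOnce P (w P eMS i) →
        ∀ i' → InL T P eMS i' → i' ≢ i →
          (pos (eMS i) < pos (eMS i'))
          ⊎ (len (eMS i) + pos (eMS i) > len (eMS i') + pos (eMS i')))
      × ((∀ i' → InL T P eMS i' → i' ≢ i →
          (pos (eMS i) < pos (eMS i'))
          ⊎ (len (eMS i) + pos (eMS i) > len (eMS i') + pos (eMS i')))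
        → OccursOnce P (w P eMS i))
lemma4 _ _ T P _ terminated _ eMS isEMS i i∈L =
  (λ once i' i'∈L → once-in-P⇒separated i∈L once i' (proj₁ i'∈L)) , separated⇒once-in-P (terminated-nonempty terminated) i∈L
  where open MatchingStatistics T P eMS isEMS
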